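{- For every finite graph $G$, $c_0(G)\le\mathcal{L}(G)$.
   Context: Lions and contamination: a lion strategy with $k\ge1$ lions on $G=(V,E)$ has initial positions $p_i(0)$ and $p_i(t)\in\{p_i(t-1)\}\cup N(p_i(t-1))$ for $t\ge1$ ($N(v)$ the neighbours of $v$); $L_t=\{p_i(t)\}_i$, $\pi_t=\{(p_i(t-1),p_i(t))\}_i$; $W_0=V\setminus L_0$, $W_t=(W_{t-1}\setminus L_t)\cup\{v\in V\setminus L_t:\exists w\in W_{t-1}\cap N(v),\ (v,w)\notin\pi_t,(w,v)\notin\pi_t\}$; it clears $G$ if $W_T=\emptyset$ for some $T$; $\mathcal{L}(G)$ is the minimum number of lions of a clearing strategy. Zero-visibility cops and robber: for $S\subseteq V$, $N(S)=\{w\in V\setminus S: w\text{ adjacent to some }v\in S\}$. With $k$ cops at initial positions $q_i(0)$, each cop at each turn $t\ge1$ stays or moves to an adjacent vertex; $P_t=\{q_i(t)\}_i$. Dirty sets: $R_0=V$, $S_t=R_t\setminus P_t$, $R_{t+1}=(N(S_t)\cup S_t)\setminus P_t$. The cops clear $G$ if $S_t=\emptyset$ for some $t$; $c_0(G)$ is the minimum number of cops that can clear $G$. -}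

module Defs where

open import Data.Nat using (ℕ; zero; suc; _≤_)
open import Data.Fin using (Fin)
open import Data.Product using (Σ; ∃; ∃-syntax; _×_; _,_)
open import Data.Sum using (_⊎_)
open import Data.Unit using (⊤)
open import Data.Empty using (⊥)
open import Relation.Nullary using (¬_)
open import Relation.Binary.PropositionalEquality using (_≡_)

record Graph : Set₁ where
  field
    n     : ℕ
    Adj   : Fin n → Fin n → Set
    sym   : ∀ {u v} → Adj u v → Adj v u
    irrefl : ∀ {v} → ¬ Adj v v

module _ (G : Graph) where
  open Graph G

  record Walks (k : ℕ) : Set where
    field
      pos   : ℕ → Fin k → Fin n
      moves : ∀ t i → pos (suc t) i ≡ pos t i ⊎ Adj (pos t i) (pos (suc t) i)

  Occ : ∀ {k} → Walks k → ℕ → Fin n → Set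
  Occ w t v = ∃[ i ] Walks.pos w t i ≡ v

  -- Lions
  -- (v , w) ∈ π_{t+1}: some lion moves from v (time t) to w (time t+1)
  InPi : ∀ {k} → Walks k → ℕ → Fin n → Fin n → Set
  InPi w t v u = ∃[ i ] (Walks.pos w t i ≡ v × Walks.pos w (suc t) i ≡ u)

  LionW : ∀ {k} → Walks k → ℕ → Fin n → Set
  LionW p zero v = ¬ Occ p zero v
  LionW p (suc t) v =
    ¬ Occ p (suc t) v ×
    (LionW p t v ⊎
     ∃[ u ] (LionW p t u × Adj v u × ¬ InPi p t v u × ¬ InPi p t u v))

  LionsClear : ∀ {k} → Walks k → Set
  LionsClear p = ∃[ T ] (∀ v → ¬ LionW p T v)

  mutual
    CopR : ∀ {k} → Walks k → ℕ → Fin n → Set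
    CopR q zero v = ⊤
    CopR q (suc t) v =
      (CopS q t v ⊎ ∃[ u ] (CopS q t u × Adj u v)) × ¬ Occ q t v

    CopS : ∀ {k} → Walks k → ℕ → Fin n → Set
    CopS q t v = CopR q t v × ¬ Occ q t v

  CopsClear : ∀ {k} → Walks k → Set
  CopsClear q = ∃[ t ] (∀ v → ¬ CopS q t v)

-- Let the cops walk exactly like the lions. By induction on t, every vertex
-- that is dirty for the cops (S_t) is contaminated for the lions (W_t): a cop
-- recontaminates v from a dirty neighbour u only if v is unoccupied at times t
-- and t+1, and then no lion can leave v or enter v, so the edge u v is not in
-- π_{t+1} and recontaminates v for the lions as well.
module Submission where

open import Defs
open import Data.Nat using (ℕ; _≤_; zero; suc)
open import Data.Nat.Properties using (≤-refl)
open import Data.Product using (∃-syntax; _×_; _,_)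
open import Data.Sum using (inj₁; inj₂)
open import Data.Fin using (Fin)

module _ (G : Graph) {k : ℕ} (p : Walks G k) where
  open Graph G

  copDirty⇒lionContaminated : ∀ t {v : Fin n} → CopS G p t v → LionW G p t v
  copDirty⇒lionContaminated zero (_ , v∉P₀) = v∉P₀
  copDirty⇒lionContaminated (suc t) ((inj₁ s , _) , v∉P₁₊ₜ) =
    v∉P₁₊ₜ , inj₁ (copDirty⇒lionContaminated t s)
  copDirty⇒lionContaminated (suc t) ((inj₂ (u , s , u~v) , v∉Pₜ) , v∉P₁₊ₜ) =
    v∉P₁₊ₜ , inj₂ (u , copDirty⇒lionContaminated t s , Graph.sym G u~v ,
      (λ { (i , leaves-v , _) → v∉Pₜ (i , leaves-v) }) ,
      (λ { (i , _ , enters-v) → v∉P₁₊ₜ (i , enters-v) }))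

  lionsClear⇒copsClear : LionsClear G p → CopsClear G p
  lionsClear⇒copsClear (T , W-empty) =
    T , λ v s → W-empty v (copDirty⇒lionContaminated T s)

lemma26 : (G : Graph) (k : ℕ) → 1 ≤ k → (p : Walks G k) → LionsClear G p →
    ∃[ j ] (j ≤ k × ∃[ q ] CopsClear G {j} q)
lemma26 G k _ p clear = k , ≤-refl , p , lionsClear⇒copsClear G p clear
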